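{- For every $n\ge2$, $E_n$ is a subgroup of $E_{n-1}\times E_{n-1}$, and $[E_{n-1}\times E_{n-1}:E_n]$ equals $1$ if $n$ is even and $2$ if $n$ is odd.
   Context: $T_\infty$ is the infinite binary rooted tree whose nodes at level $m\ge0$ are the words of length $m$ over $\{a,b\}$ (root $x_0$ = empty word), each $w$ joined to $wa$ and $wb$; $T_n$ is the subtree of words of length $\le n$; $\mathrm{Aut}(T_\infty)$, $\mathrm{Aut}(T_n)$ are the root-preserving automorphism groups. $\mathrm{Par}(\sigma,x)=0$ if $\sigma(xa)=\sigma(x)a$ and $\sigma(xb)=\sigma(x)b$, and $=1$ if $\sigma(xa)=\sigma(x)b$ and $\sigma(xb)=\sigma(x)a$. For $\sigma\in\mathrm{Aut}(T_\infty)$: $Q(\sigma,x):=\sum_{i\ge0}2^i\sum_{s_1,\ldots,s_i\in\{a,b\}}\mathrm{Par}(\sigma,x\,a\,s_1\,a\,s_2\cdots a\,s_i)\in\mathbb{Z}_2$ (concatenated words), $P(\sigma,x):=(-1)^{\mathrm{Par}(\sigma,x)}+2\sum_{t\in\{a,b\}}Q(\sigma,xbt)-2\sum_{t\in\{a,b\}}Q(\sigma,xat)\in\mathbb{Z}_2^\times$. For $\tau\in\mathrm{Aut}(T_n)$ and $x$ of length $m\le n$, $P(\tau,x):=P(\tilde\tau,x)\bmod 2^{\lfloor(n-m+1)/2\rfloor}$ for any extension $\tilde\tau\in\mathrm{Aut}(T_\infty)$ of $\tau$ (independent of the choice). $M_n:=\{\sigma\in\mathrm{Aut}(T_n):$ for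 all $m\ge0$ and words $x$ of length $m$, $P(\sigma,x)\equiv P(\sigma,x_0)\pmod{2^{\lfloor(n-m+1)/2\rfloor}}\}$. $B'_n:=\{\sigma\in M_n: P(\sigma,x_0)\equiv1\pmod{2^{\lfloor(n+1)/2\rfloor}}\}$. $E_n:=\{\sigma\in B'_n:\sigma$ fixes every node of length $\le n-1\}$. The group $E_{n-1}\times E_{n-1}$ acts on $T_n$ by $(\sigma_a,\sigma_b)(aw)=a\,\sigma_a(w)$, $(\sigma_a,\sigma_b)(bw)=b\,\sigma_b(w)$ (and fixing the root), and is thereby regarded as a subgroup of $\mathrm{Aut}(T_n)$. -}

module Defs where

open import Data.Bool using (Bool; true; false; if_then_else_; _∧_; _xor_; not)
open import Data.Nat using (ℕ; zero; suc; _+_; _*_; _∸_; _^_; ⌊_/2⌋)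
open import Data.Nat.Divisibility using (_∣?_)
open import Data.Integer using (ℤ; +_; _-_) renaming (_+_ to _+ℤ_; _*_ to _*ℤ_)
import Data.Integer as ℤ
open import Data.List using (List; []; _∷_; _++_; concatMap; map; length; filter; upTo; foldr)
import Data.Bool as B
open import Relation.Nullary.Decidable using (⌊_⌋)
open import Relation.Binary.PropositionalEquality using (_≡_)

-- Words over {a,b}: nodes of the binary tree T_∞ (root x₀ = [])

data Letter : Set where
  a b : Letter

Word : Set
Word = List Letter

_==L_ : Letter → Letter → Bool
a ==L a = true
b ==L b = true
_ ==L _ = false

_==W_ : Word → Word → Bool
[] ==W [] = true
(x ∷ xs) ==W (y ∷ ys) = (x ==L y) ∧ (xs ==W ys)
_ ==W _ = false

wordsOf : ℕ → List Word
wordsOf zero = [] ∷ []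
wordsOf (suc m) = concatMap (λ w → (a ∷ w) ∷ (b ∷ w) ∷ []) (wordsOf m)

words≤ : ℕ → List Word
words≤ n = concatMap wordsOf (upTo (suc n))

-- Aut(T_n), encoded by portraits (wreath recursion): an automorphism of
-- T_(n+1) is its root parity together with the automorphisms it induces
-- on the subtrees below a and b (indexed by the domain subtree).

data Aut : ℕ → Set where
  leaf : Aut zero
  node : {n : ℕ} → Bool → Aut n → Aut n → Aut (suc n)

-- action σ(w) on nodes (beyond depth n the identity extension is used)
act : {n : ℕ} → Aut n → Word → Word
act leaf w = w
act (node p l r) [] = []
act (node p l r) (a ∷ w) = (if p then b else a) ∷ act l w
act (node p l r) (b ∷ w) = (if p then a else b) ∷ act r w

-- Par(σ,x); for nodes outside T_n (|x| ≥ n) this is the parity of the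
-- identity extension of σ to T_∞, namely 0.
Par : {n : ℕ} → Aut n → Word → Bool
Par leaf x = false
Par (node p l r) [] = p
Par (node p l r) (a ∷ x) = Par l x
Par (node p l r) (b ∷ x) = Par r x

-- group structure: identity, composition (σ ∘ τ)(w) = σ(τ(w)), inverse
idA : (n : ℕ) → Aut n
idA zero = leaf
idA (suc n) = node false (idA n) (idA n)

_∘A_ : {n : ℕ} → Aut n → Aut n → Aut n
leaf ∘A leaf = leaf
node q σa σb ∘A node p τa τb =
  node (p xor q) ((if p then σb else σa) ∘A τa) ((if p then σa else σb) ∘A τb)

invA : {n : ℕ} → Aut n → Aut n
invA leaf = leaf
invA (node p l r) =
  node p (if p then invA r else invA l) (if p then invA l else invA r)

-- E_{n-1} × E_{n-1} ↪ Aut(T_n):  (σa,σb)(a w) = a σa(w), (σa,σb)(b w) = b σb(w)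
embed : {n : ℕ} → Aut n → Aut n → Aut (suc n)
embed σa σb = node false σa σb

allAut : (n : ℕ) → List (Aut n)
allAut zero = leaf ∷ []
allAut (suc n) =
  concatMap (λ p → concatMap (λ l → map (λ r → node p l r) (allAut n)) (allAut n))
            (false ∷ true ∷ [])

aWords : ℕ → List Word
aWords zero = [] ∷ []
aWords (suc i) = concatMap (λ w → (w ++ (a ∷ a ∷ [])) ∷ (w ++ (a ∷ b ∷ [])) ∷ []) (aWords i)

bit : Bool → ℕ
bit true = 1
bit false = 0

sumℕ : List ℕ → ℕ
sumℕ = foldr _+_ 0

Qterm : {n : ℕ} → Aut n → Word → ℕ → ℕ
Qterm σ x i = sumℕ (map (λ w → bit (Par σ (x ++ w))) (aWords i))

-- Q(σ,x) truncated to the terms i < K  (≡ Q(σ,x) mod 2^K)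
Qtr : {n : ℕ} → Aut n → Word → ℕ → ℕ
Qtr σ x zero = 0
Qtr σ x (suc K) = Qtr σ x K + 2 ^ K * Qterm σ x K

sign : Bool → ℤ
sign true = ℤ.-[1+ 0 ]
sign false = + 1

-- P(σ,x) computed with Q truncated to i < k ∸ 1; this is ≡ P(σ,x) mod 2^k
Ptr : {n : ℕ} → Aut n → Word → ℕ → ℤ
Ptr σ x k =
  sign (Par σ x)
  +ℤ (+ 2) *ℤ (+ (Qtr σ (x ++ (b ∷ a ∷ [])) (k ∸ 1) + Qtr σ (x ++ (b ∷ b ∷ [])) (k ∸ 1)))
  -  (+ 2) *ℤ (+ (Qtr σ (x ++ (a ∷ a ∷ [])) (k ∸ 1) + Qtr σ (x ++ (a ∷ b ∷ [])) (k ∸ 1)))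

all : {A : Set} → (A → Bool) → List A → Bool
all f = foldr (λ x r → f x ∧ r) true

congMod : ℤ → ℤ → ℕ → Bool
congMod u v k = ⌊ 2 ^ k ∣? ℤ.∣ u - v ∣ ⌋

prec : ℕ → ℕ → ℕ
prec n m = ⌊ suc (n ∸ m) /2⌋

isM : (n : ℕ) → Aut n → Bool
isM n σ = all (λ x → congMod (Ptr σ x (prec n (length x))) (Ptr σ [] (prec n (length x)))
                              (prec n (length x)))
              (words≤ n)

isB' : (n : ℕ) → Aut n → Bool
isB' n σ = isM n σ ∧ congMod (Ptr σ [] (prec n 0)) (+ 1) (prec n 0)

fixesUpTo : {n : ℕ} → ℕ → Aut n → Bool
fixesUpTo d σ = all (λ x → act σ x ==W x) (words≤ d)

isE : (n : ℕ) → Aut n → Bool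
isE n σ = isB' n σ ∧ fixesUpTo (n ∸ 1) σ


cardE : (n : ℕ) → ℕ
cardE n = length (filter (λ σ → isE n σ B.≟ true) (allAut n))

{-# OPTIONS --safe #-}
module Submission where

-- An element σ of E_n fixes T_{n−1}, so all its nontrivial parities lie on level D = n − 1 and
-- Q(σ,y) is the single term 2^i · #{s : Par(σ, y a s₁ ⋯ a sᵢ) = 1} with |y| + 2i = D. Hence the
-- congruence required of P(σ,x) holds automatically unless D − |x| = 2i + 2 is even and positive;
-- there P(σ,x) = 1 + 2^{i+1}(B − A), with A and B counting the nontrivial parities below
-- x a t (a s)^i and x b t (a s)^i, and the condition says that A + B is even. These parity
-- conditions are additive under composition and every element is an involution, so E_n is a group.
-- The conditions below a and below b are those of E_{n−1}; the root adds one only when n is odd,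
-- namely g(σa) = g(σb) where g(τ) is the parity of the count below a (a s)^i and b (a s)^i.
-- So E_n = E_{n−1} × E_{n−1} for even n, while for odd n the index is 2 because g takes both
-- values equally often on E_{n−1}; this equidistribution, together with that of the parity of
-- the count below (a s)^i, is proved by a joint induction on n.

open import Defs
open import Algebra.Bundles using (CommutativeRing)
open import Data.Bool using (Bool; true; false; _∧_; _xor_; not)
import Data.Bool as B
open import Data.Bool.Properties
  using (xor-comm; xor-∧-commutativeRing; ∧-identityʳ; not-involutive; not-distribˡ-xor; ⇔→≡; T-≡; ¬-not)
open import Data.Integer using (+_) renaming (_+_ to _+ℤ_; _*_ to _*ℤ_; _-_ to _-ℤ_)
import Data.Integer as ℤ
import Data.Integer.Properties as ℤP
open import Data.Integer.Tactic.RingSolver using () renaming (solve-∀ to ℤ-solve-∀)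
open import Data.List using (List; []; _∷_; _++_; map; length; filter; concatMap)
open import Data.List.Membership.Propositional using (_∈_)
open import Data.List.Membership.Propositional.Properties using (∈-concatMap⁺; ∈-upTo⁺)
open import Data.List.Properties using (∷-injectiveʳ; length-++; map-∘; map-cong; map-++)
open import Data.List.Relation.Unary.All as All using (All; []; _∷_)
open import Data.List.Relation.Unary.All.Properties using (concat⁺; map⁺; applyUpTo⁺₁)
open import Data.List.Relation.Unary.Any as Any using (here; there)
open import Data.Nat using (NonZero; ℕ; zero; suc; _+_; _*_; _∸_; _^_; _≤_; _<_; z≤n; s≤s; ⌊_/2⌋; ∣_-_∣; _%_)
open import Data.Nat.Divisibility
  using (_∣_; _∣0; 1∣_; ∣-refl; ∣1⇒≡1; ∣m+n∣m⇒∣n; ∣m∣n⇒∣m+n; *-cancelˡ-∣; *-monoʳ-∣)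
open import Data.Nat.ListAction.Properties using (sum-++)
open import Data.Nat.Properties
open import Data.Nat.Tactic.RingSolver using () renaming (solve-∀ to ℕ-solve-∀)
open import Data.Product using (Σ; _×_; _,_; proj₁; proj₂)
open import Data.Sum using (inj₁; inj₂)
open import Function using (_∘_; _⇔_; mk⇔; Equivalence; case_of_)
open import Function.Properties.Equivalence using (⇔-setoid)
open import Level using (0ℓ)
open import Relation.Binary.Definitions using (tri<; tri≈; tri>)
open import Relation.Binary.PropositionalEquality
import Relation.Binary.Reasoning.Setoid as SetoidReasoning
open import Relation.Nullary using (contradiction)
open import Relation.Nullary.Decidable using (toWitness; fromWitness)
open import Algebra.Properties.CommutativeSemigroup
  (CommutativeRing.+-commutativeSemigroup xor-∧-commutativeRing) using () renaming (interchange to xor-interchange)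
open import Algebra.Properties.CommutativeSemigroup +-commutativeSemigroup
  using () renaming (interchange to +-interchange)

∧≡true⇔ : ∀ {x y} → x ∧ y ≡ true ⇔ (x ≡ true × y ≡ true)
∧≡true⇔ {true} = mk⇔ (refl ,_) proj₂
∧≡true⇔ {false} = mk⇔ (λ ()) (λ ())

not≡true⇔ : ∀ {x} → not x ≡ true ⇔ x ≡ false
not≡true⇔ {false} = mk⇔ (λ _ → refl) (λ _ → refl)
not≡true⇔ {true} = mk⇔ (λ ()) (λ ())

not∧∧≡true⇔ : ∀ {p x y} → not p ∧ (x ∧ y) ≡ true ⇔ (p ≡ false × x ≡ true × y ≡ true)
not∧∧≡true⇔ {false} {true} {true} = mk⇔ (λ _ → refl , refl , refl) (λ _ → refl)
not∧∧≡true⇔ {false} {true} {false} = mk⇔ (λ ()) (λ ())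
not∧∧≡true⇔ {false} {false} = mk⇔ (λ ()) (λ ())
not∧∧≡true⇔ {true} = mk⇔ (λ ()) (λ ())

all≡true⇔ : ∀ {A : Set} (f : A → Bool) xs → all f xs ≡ true ⇔ All (λ x → f x ≡ true) xs
all≡true⇔ f [] = mk⇔ (λ _ → []) (λ _ → refl)
all≡true⇔ f (x ∷ xs) = mk⇔
  (λ h → let fx , rest = Equivalence.to ∧≡true⇔ h in fx ∷ Equivalence.to (all≡true⇔ f xs) rest)
  (λ { (fx ∷ rest) → Equivalence.from ∧≡true⇔ (fx , Equivalence.from (all≡true⇔ f xs) rest) })

==W⇔≡ : ∀ x y → (x ==W y) ≡ true ⇔ x ≡ y
==W⇔≡ [] [] = mk⇔ (λ _ → refl) (λ _ → refl)
==W⇔≡ [] (_ ∷ _) = mk⇔ (λ ()) (λ ())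
==W⇔≡ (_ ∷ _) [] = mk⇔ (λ ()) (λ ())
==W⇔≡ (a ∷ x) (a ∷ y) = mk⇔ (cong (a ∷_) ∘ Equivalence.to (==W⇔≡ x y)) (Equivalence.from (==W⇔≡ x y) ∘ ∷-injectiveʳ)
==W⇔≡ (b ∷ x) (b ∷ y) = mk⇔ (cong (b ∷_) ∘ Equivalence.to (==W⇔≡ x y)) (Equivalence.from (==W⇔≡ x y) ∘ ∷-injectiveʳ)
==W⇔≡ (a ∷ x) (b ∷ y) = mk⇔ (λ ()) (λ ())
==W⇔≡ (b ∷ x) (a ∷ y) = mk⇔ (λ ()) (λ ())

wordsOf-length : ∀ m → All (λ x → length x ≡ m) (wordsOf m)
wordsOf-length zero = refl ∷ []
wordsOf-length (suc m) = concat⁺ (map⁺ (All.map (λ eq → cong suc eq ∷ cong suc eq ∷ []) (wordsOf-length m)))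

∈-wordsOf : ∀ x → x ∈ wordsOf (length x)
∈-wordsOf [] = here refl
∈-wordsOf (a ∷ x) = ∈-concatMap⁺ _ (Any.map (λ { refl → here refl }) (∈-wordsOf x))
∈-wordsOf (b ∷ x) = ∈-concatMap⁺ _ (Any.map (λ { refl → there (here refl) }) (∈-wordsOf x))

words≤-length : ∀ n → All (λ x → length x ≤ n) (words≤ n)
words≤-length n = concat⁺ (map⁺ {f = wordsOf} (applyUpTo⁺₁ (λ m → m) (suc n)
  (λ {m} m<1+n → All.map (λ { refl → ≤-pred m<1+n }) (wordsOf-length m))))

∈-words≤ : ∀ {n} x → length x ≤ n → x ∈ words≤ n
∈-words≤ x ≤n = ∈-concatMap⁺ wordsOf (Any.map (λ { refl → ∈-wordsOf x }) (∈-upTo⁺ (s≤s ≤n)))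

all-words≤⇔ : ∀ (f : Word → Bool) n → all f (words≤ n) ≡ true ⇔ (∀ x → length x ≤ n → f x ≡ true)
all-words≤⇔ f n = mk⇔
  (λ h x ≤n → All.lookup (Equivalence.to (all≡true⇔ f _) h) (∈-words≤ x ≤n))
  (λ h → Equivalence.from (all≡true⇔ f _) (All.map (λ {x} → h x) (words≤-length n)))

sum-map-zero : ∀ {A : Set} {f : A → ℕ} {xs} → All (λ x → f x ≡ 0) xs → sumℕ (map f xs) ≡ 0
sum-map-zero [] = refl
sum-map-zero (fx≡0 ∷ rest) = cong₂ _+_ fx≡0 (sum-map-zero rest)

sum-map-concatMap : ∀ {A B : Set} (f : B → ℕ) (g : A → List B) xs →
  sumℕ (map f (concatMap g xs)) ≡ sumℕ (map (λ x → sumℕ (map f (g x))) xs)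
sum-map-concatMap f g [] = refl
sum-map-concatMap f g (x ∷ xs) = begin
  sumℕ (map f (g x ++ concatMap g xs))                ≡⟨ cong sumℕ (map-++ f (g x) (concatMap g xs)) ⟩
  sumℕ (map f (g x) ++ map f (concatMap g xs))        ≡⟨ sum-++ (map f (g x)) (map f (concatMap g xs)) ⟩
  sumℕ (map f (g x)) + sumℕ (map f (concatMap g xs))  ≡⟨ cong (_+_ (sumℕ (map f (g x)))) (sum-map-concatMap f g xs) ⟩
  sumℕ (map f (g x)) + sumℕ (map (λ x → sumℕ (map f (g x))) xs) ∎
  where open ≡-Reasoning

sum-map-+ : ∀ {A : Set} (f g : A → ℕ) xs → sumℕ (map (λ x → f x + g x) xs) ≡ sumℕ (map f xs) + sumℕ (map g xs)
sum-map-+ f g [] = refl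
sum-map-+ f g (x ∷ xs) = trans (cong (_+_ (f x + g x)) (sum-map-+ f g xs)) (+-interchange (f x) (g x) _ _)

sum-map-*ˡ : ∀ {A : Set} c (f : A → ℕ) xs → sumℕ (map (λ x → c * f x) xs) ≡ c * sumℕ (map f xs)
sum-map-*ˡ c f [] = sym (*-zeroʳ c)
sum-map-*ˡ c f (x ∷ xs) = trans (cong (_+_ (c * f x)) (sum-map-*ˡ c f xs)) (sym (*-distribˡ-+ c (f x) _))

sum-map-*ʳ : ∀ {A : Set} c (f : A → ℕ) xs → sumℕ (map (λ x → f x * c) xs) ≡ sumℕ (map f xs) * c
sum-map-*ʳ c f [] = refl
sum-map-*ʳ c f (x ∷ xs) = trans (cong (_+_ (f x * c)) (sum-map-*ʳ c f xs)) (sym (*-distribʳ-+ c (f x) _))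

length-filter≡count : ∀ {A : Set} (f : A → Bool) xs → length (filter (λ x → f x B.≟ true) xs) ≡ sumℕ (map (bit ∘ f) xs)
length-filter≡count f [] = refl
length-filter≡count f (x ∷ xs) with f x
... | true = cong suc (length-filter≡count f xs)
... | false = length-filter≡count f xs

odd : ℕ → Bool
odd zero = false
odd (suc n) = not (odd n)

odd-+ : ∀ m n → odd (m + n) ≡ odd m xor odd n
odd-+ zero n = refl
odd-+ (suc m) n = trans (cong not (odd-+ m n)) (not-distribˡ-xor (odd m) (odd n))

odd-bit : ∀ c → odd (bit c) ≡ c
odd-bit true = refl
odd-bit false = refl

odd-∣-∣ : ∀ m n → odd ∣ m - n ∣ ≡ odd (m + n)
odd-∣-∣ zero n = refl
odd-∣-∣ (suc m) zero = cong (odd ∘ suc) (sym (+-identityʳ m))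
odd-∣-∣ (suc m) (suc n) = trans (odd-∣-∣ m n) (trans (sym (not-involutive _)) (cong (not ∘ odd) (sym (+-suc m n))))

2∣⇔even : ∀ n → 2 ∣ n ⇔ odd n ≡ false
2∣⇔even zero = mk⇔ (λ _ → refl) (λ _ → 2 ∣0)
2∣⇔even (suc zero) = mk⇔ (λ 2∣1 → contradiction (∣1⇒≡1 2∣1) λ ()) (λ ())
2∣⇔even (suc (suc n)) = mk⇔
  (λ 2∣2+n → trans (not-involutive (odd n)) (Equivalence.to (2∣⇔even n) (∣m+n∣m⇒∣n 2∣2+n ∣-refl)))
  (λ even → ∣m∣n⇒∣m+n (∣-refl {2}) (Equivalence.from (2∣⇔even n) (trans (sym (not-involutive (odd n))) even)))

odd-+-additive : ∀ {A : Set} (h f g : A → ℕ) → (∀ y → odd (h y) ≡ odd (f y) xor odd (g y)) →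
  ∀ y z → odd (h y + h z) ≡ odd (f y + f z) xor odd (g y + g z)
odd-+-additive h f g additive y z = begin
  odd (h y + h z)                                      ≡⟨ odd-+ (h y) (h z) ⟩
  odd (h y) xor odd (h z)                              ≡⟨ cong₂ _xor_ (additive y) (additive z) ⟩
  (odd (f y) xor odd (g y)) xor (odd (f z) xor odd (g z)) ≡⟨ xor-interchange (odd (f y)) (odd (g y)) (odd (f z)) (odd (g z)) ⟩
  (odd (f y) xor odd (f z)) xor (odd (g y) xor odd (g z)) ≡⟨ sym (cong₂ _xor_ (odd-+ (f y) (f z)) (odd-+ (g y) (g z))) ⟩
  odd (f y + f z) xor odd (g y + g z)                  ∎
  where open ≡-Reasoning

odd-count-xor : ∀ {A : Set} (h f g : A → Bool) → (∀ x → h x ≡ f x xor g x) →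
  ∀ xs → odd (sumℕ (map (bit ∘ h) xs)) ≡ odd (sumℕ (map (bit ∘ f) xs)) xor odd (sumℕ (map (bit ∘ g) xs))
odd-count-xor h f g h≡ [] = refl
odd-count-xor {A} h f g h≡ (x ∷ xs) = begin
  odd (bit (h x) + count h)                   ≡⟨ odd-+ (bit (h x)) (count h) ⟩
  odd (bit (h x)) xor odd (count h)           ≡⟨ cong₂ _xor_ (trans (odd-bit (h x)) (h≡ x)) (odd-count-xor h f g h≡ xs) ⟩
  (f x xor g x) xor (odd (count f) xor odd (count g)) ≡⟨ xor-interchange (f x) (g x) (odd (count f)) (odd (count g)) ⟩
  (f x xor odd (count f)) xor (g x xor odd (count g))
    ≡⟨ sym (cong₂ _xor_ (trans (odd-+ (bit (f x)) (count f)) (cong (_xor odd (count f)) (odd-bit (f x))))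
                         (trans (odd-+ (bit (g x)) (count g)) (cong (_xor odd (count g)) (odd-bit (g x))))) ⟩
  odd (bit (f x) + count f) xor odd (bit (g x) + count g) ∎
  where
    open ≡-Reasoning
    count : (A → Bool) → ℕ
    count k = sumℕ (map (bit ∘ k) xs)

double : ℕ → ℕ
double zero = zero
double (suc i) = suc (suc (double i))

double-mono-≤ : ∀ {i j} → i ≤ j → double i ≤ double j
double-mono-≤ z≤n = z≤n
double-mono-≤ (s≤s i≤j) = s≤s (s≤s (double-mono-≤ i≤j))

double≢suc-double : ∀ i j → double i ≢ suc (double j)
double≢suc-double zero j ()
double≢suc-double (suc i) zero ()
double≢suc-double (suc i) (suc j) eq = double≢suc-double i j (suc-injective (suc-injective eq))

double-injective : ∀ {i j} → double i ≡ double j → i ≡ j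
double-injective {zero} {zero} _ = refl
double-injective {suc i} {suc j} eq = cong suc (double-injective (suc-injective (suc-injective eq)))

⌊double/2⌋ : ∀ i → ⌊ double i /2⌋ ≡ i
⌊double/2⌋ zero = refl
⌊double/2⌋ (suc i) = cong suc (⌊double/2⌋ i)

⌊suc-double/2⌋ : ∀ i → ⌊ suc (double i) /2⌋ ≡ i
⌊suc-double/2⌋ zero = refl
⌊suc-double/2⌋ (suc i) = cong suc (⌊suc-double/2⌋ i)

double%2 : ∀ i → double i % 2 ≡ 0
double%2 zero = refl
double%2 (suc i) = double%2 i

suc-double%2 : ∀ i → suc (double i) % 2 ≡ 1
suc-double%2 zero = refl
suc-double%2 (suc i) = suc-double%2 i

data Distance (m D : ℕ) : Set where
  beyond   : D < m → Distance m D
  even-gap : ∀ i → m + double i ≡ D → Distance m D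
  odd-gap  : ∀ i → m + suc (double i) ≡ D → Distance m D

distance : ∀ m D → Distance m D
distance zero zero = even-gap 0 refl
distance zero (suc D) with distance zero D
... | even-gap i eq = odd-gap i (cong suc eq)
... | odd-gap i eq = even-gap (suc i) (cong suc eq)
distance (suc m) zero = beyond (s≤s z≤n)
distance (suc m) (suc D) with distance m D
... | beyond D<m = beyond (s≤s D<m)
... | even-gap i eq = even-gap i (cong suc eq)
... | odd-gap i eq = odd-gap i (cong suc eq)

congMod≡true⇔ : ∀ u v k → congMod u v k ≡ true ⇔ 2 ^ k ∣ ℤ.∣ u -ℤ v ∣
congMod≡true⇔ u v k = mk⇔ (toWitness ∘ Equivalence.from T-≡) (Equivalence.to T-≡ ∘ fromWitness)

congMod-refl : ∀ u k → congMod u u k ≡ true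
congMod-refl u k = Equivalence.from (congMod≡true⇔ u u k)
  (subst (λ z → 2 ^ k ∣ ℤ.∣ z ∣) (sym (ℤP.+-inverseʳ u)) (_∣0 (2 ^ k)))

congMod-zero : ∀ u v → congMod u v 0 ≡ true
congMod-zero u v = Equivalence.from (congMod≡true⇔ u v 0) (1∣ _)

-- the value of Ptr σ x 1, whose truncated Q-sums are empty
congMod-sign : ∀ c → congMod (sign c +ℤ + 2 *ℤ + 0 -ℤ + 2 *ℤ + 0) (+ 1) 1 ≡ true
congMod-sign true = refl
congMod-sign false = refl

∣+m-+n∣≡∣m-n∣ : ∀ m n → ℤ.∣ + m -ℤ + n ∣ ≡ ∣ m - n ∣
∣+m-+n∣≡∣m-n∣ m n with ≤-total m n
... | inj₁ m≤n = trans (cong ℤ.∣_∣ (ℤP.m-n≡m⊖n m n)) (trans (ℤP.∣⊖∣-≤ m≤n) (sym (m≤n⇒∣m-n∣≡n∸m m≤n)))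
... | inj₂ n≤m = trans (cong ℤ.∣_∣ (ℤP.m-n≡m⊖n m n)) (trans (ℤP.∣m⊖n∣≡∣n⊖m∣ m n)
                   (trans (ℤP.∣⊖∣-≤ n≤m) (sym (m≤n⇒∣n-m∣≡n∸m n≤m))))

*-cancelˡ-∣⇔ : ∀ c {m n} .{{_ : NonZero c}} → c * m ∣ c * n ⇔ m ∣ n
*-cancelˡ-∣⇔ c = mk⇔ (*-cancelˡ-∣ c) (*-monoʳ-∣ c)

∣1+2^[1+i][B-A]-1∣ : ∀ i A B →
  ℤ.∣ (+ 1 +ℤ + 2 *ℤ + (2 ^ i * B) -ℤ + 2 *ℤ + (2 ^ i * A)) -ℤ + 1 ∣ ≡ 2 ^ suc i * ∣ B - A ∣
∣1+2^[1+i][B-A]-1∣ i A B = begin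
  ℤ.∣ (+ 1 +ℤ + 2 *ℤ + (2 ^ i * B) -ℤ + 2 *ℤ + (2 ^ i * A)) -ℤ + 1 ∣
    ≡⟨ cong ℤ.∣_∣ (cancel-1 (+ 2 *ℤ + (2 ^ i * B)) (+ 2 *ℤ + (2 ^ i * A))) ⟩
  ℤ.∣ + 2 *ℤ + (2 ^ i * B) -ℤ + 2 *ℤ + (2 ^ i * A) ∣
    ≡⟨ cong₂ (λ p q → ℤ.∣ p -ℤ q ∣) (sym (ℤP.pos-* 2 (2 ^ i * B))) (sym (ℤP.pos-* 2 (2 ^ i * A))) ⟩
  ℤ.∣ + (2 * (2 ^ i * B)) -ℤ + (2 * (2 ^ i * A)) ∣
    ≡⟨ ∣+m-+n∣≡∣m-n∣ (2 * (2 ^ i * B)) (2 * (2 ^ i * A)) ⟩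
  ∣ 2 * (2 ^ i * B) - 2 * (2 ^ i * A) ∣
    ≡⟨ cong₂ ∣_-_∣ (sym (*-assoc 2 (2 ^ i) B)) (sym (*-assoc 2 (2 ^ i) A)) ⟩
  ∣ 2 ^ suc i * B - 2 ^ suc i * A ∣
    ≡⟨ sym (*-distribˡ-∣-∣ (2 ^ suc i) B A) ⟩
  2 ^ suc i * ∣ B - A ∣ ∎
  where
    open ≡-Reasoning
    cancel-1 : ∀ p q → (+ 1 +ℤ p -ℤ q) -ℤ + 1 ≡ p -ℤ q
    cancel-1 = ℤ-solve-∀

congMod-1+2^[1+i][B-A] : ∀ i A B →
  congMod (+ 1 +ℤ + 2 *ℤ + (2 ^ i * B) -ℤ + 2 *ℤ + (2 ^ i * A)) (+ 1) (2 + i) ≡ not (odd (B + A))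
congMod-1+2^[1+i][B-A] i A B = ⇔→≡ (begin
  congMod u (+ 1) (2 + i) ≡ true          ≈⟨ congMod≡true⇔ u (+ 1) (2 + i) ⟩
  2 ^ (2 + i) ∣ ℤ.∣ u -ℤ + 1 ∣             ≡⟨ cong₂ _∣_ (*-comm 2 (2 ^ suc i)) (∣1+2^[1+i][B-A]-1∣ i A B) ⟩
  2 ^ suc i * 2 ∣ 2 ^ suc i * d           ≈⟨ *-cancelˡ-∣⇔ (2 ^ suc i) {{m^n≢0 2 (suc i)}} ⟩
  2 ∣ d                                   ≈⟨ 2∣⇔even d ⟩
  odd d ≡ false                           ≡⟨ cong (_≡ false) (odd-∣-∣ B A) ⟩
  odd (B + A) ≡ false                     ≈⟨ not≡true⇔ ⟨
  not (odd (B + A)) ≡ true                ∎)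
  where
    open SetoidReasoning (⇔-setoid 0ℓ)
    u = + 1 +ℤ + 2 *ℤ + (2 ^ i * B) -ℤ + 2 *ℤ + (2 ^ i * A)
    d = ∣ B - A ∣

data FixesUpTo : {n : ℕ} → ℕ → Aut n → Set where
  fixes-root : ∀ {n} {σ : Aut n} → FixesUpTo zero σ
  fixes-leaf : ∀ {d} → FixesUpTo d leaf
  fixes-node : ∀ {n d} {l r : Aut n} → FixesUpTo d l → FixesUpTo d r → FixesUpTo (suc d) (node false l r)

act-fixed : ∀ {n d} {σ : Aut n} → FixesUpTo d σ → ∀ x → length x ≤ d → act σ x ≡ x
act-fixed {σ = leaf} _ x _ = refl
act-fixed {σ = node _ _ _} _ [] _ = refl
act-fixed (fixes-node fl fr) (a ∷ x) (s≤s ≤d) = cong (a ∷_) (act-fixed fl x ≤d)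
act-fixed (fixes-node fl fr) (b ∷ x) (s≤s ≤d) = cong (b ∷_) (act-fixed fr x ≤d)

fixed⇒FixesUpTo : ∀ {n} d (σ : Aut n) → (∀ x → length x ≤ d → act σ x ≡ x) → FixesUpTo d σ
fixed⇒FixesUpTo zero σ _ = fixes-root
fixed⇒FixesUpTo (suc d) leaf _ = fixes-leaf
fixed⇒FixesUpTo (suc d) (node true l r) fixed with fixed (a ∷ []) (s≤s z≤n)
... | ()
fixed⇒FixesUpTo (suc d) (node false l r) fixed = fixes-node
  (fixed⇒FixesUpTo d l (λ x ≤d → ∷-injectiveʳ (fixed (a ∷ x) (s≤s ≤d))))
  (fixed⇒FixesUpTo d r (λ x ≤d → ∷-injectiveʳ (fixed (b ∷ x) (s≤s ≤d))))

fixesUpTo⇔FixesUpTo : ∀ {n} d (σ : Aut n) → fixesUpTo d σ ≡ true ⇔ FixesUpTo d σ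
fixesUpTo⇔FixesUpTo d σ = mk⇔
  (λ h → fixed⇒FixesUpTo d σ (λ x ≤d → Equivalence.to (==W⇔≡ _ x) (Equivalence.to (all-words≤⇔ _ d) h x ≤d)))
  (λ fix → Equivalence.from (all-words≤⇔ _ d) (λ x ≤d → Equivalence.from (==W⇔≡ _ x) (act-fixed fix x ≤d)))

Par-fixed : ∀ {n d} {σ : Aut n} → FixesUpTo d σ → ∀ x → length x < d → Par σ x ≡ false
Par-fixed fixes-leaf x _ = refl
Par-fixed (fixes-node fl fr) [] _ = refl
Par-fixed (fixes-node fl fr) (a ∷ x) (s≤s <d) = Par-fixed fl x <d
Par-fixed (fixes-node fl fr) (b ∷ x) (s≤s <d) = Par-fixed fr x <d

Par-beyond : ∀ {n} (σ : Aut n) x → n ≤ length x → Par σ x ≡ false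
Par-beyond leaf x _ = refl
Par-beyond (node p l r) (a ∷ x) (s≤s n≤) = Par-beyond l x n≤
Par-beyond (node p l r) (b ∷ x) (s≤s n≤) = Par-beyond r x n≤

fixes-idA : ∀ d n → FixesUpTo d (idA n)
fixes-idA zero n = fixes-root
fixes-idA (suc d) zero = fixes-leaf
fixes-idA (suc d) (suc n) = fixes-node (fixes-idA d n) (fixes-idA d n)

fixes-∘ : ∀ {n d} {σ τ : Aut n} → FixesUpTo d σ → FixesUpTo d τ → FixesUpTo d (σ ∘A τ)
fixes-∘ {d = zero} _ _ = fixes-root
fixes-∘ fixes-leaf fixes-leaf = fixes-leaf
fixes-∘ (fixes-node σl σr) (fixes-node τl τr) = fixes-node (fixes-∘ σl τl) (fixes-∘ σr τr)

invA≡self : ∀ {D} {σ : Aut (suc D)} → FixesUpTo D σ → invA σ ≡ σ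
invA≡self {σ = node false leaf leaf} _ = refl
invA≡self {σ = node true leaf leaf} _ = refl
invA≡self (fixes-node fl fr) = cong₂ (node false) (invA≡self fl) (invA≡self fr)

Par-∘ : ∀ {n} (σ τ : Aut n) x → Par (σ ∘A τ) x ≡ Par τ x xor Par σ (act τ x)
Par-∘ leaf leaf x = refl
Par-∘ (node q σa σb) (node p τa τb) [] = refl
Par-∘ (node q σa σb) (node false τa τb) (a ∷ x) = Par-∘ σa τa x
Par-∘ (node q σa σb) (node false τa τb) (b ∷ x) = Par-∘ σb τb x
Par-∘ (node q σa σb) (node true τa τb) (a ∷ x) = Par-∘ σb τa x
Par-∘ (node q σa σb) (node true τa τb) (b ∷ x) = Par-∘ σa τb x

Par-∘-fixing : ∀ {D} (σ τ : Aut (suc D)) → FixesUpTo D τ → ∀ x → Par (σ ∘A τ) x ≡ Par σ x xor Par τ x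
Par-∘-fixing {D} σ τ fix x with ≤-<-connex (length x) D
... | inj₁ ≤D = begin
  Par (σ ∘A τ) x            ≡⟨ Par-∘ σ τ x ⟩
  Par τ x xor Par σ (act τ x) ≡⟨ cong (λ y → Par τ x xor Par σ y) (act-fixed fix x ≤D) ⟩
  Par τ x xor Par σ x       ≡⟨ xor-comm (Par τ x) (Par σ x) ⟩
  Par σ x xor Par τ x       ∎
  where open ≡-Reasoning
... | inj₂ D< rewrite Par-beyond (σ ∘A τ) x D< | Par-beyond σ x D< | Par-beyond τ x D< = refl

-- Automorphisms concentrated on the last level

prec-gap : ∀ {m e D} → m + e ≡ D → prec (suc D) m ≡ suc ⌊ e /2⌋
prec-gap {m} {e} refl = cong (λ k → ⌊ suc k /2⌋) (trans (cong (_∸ m) (sym (+-suc m e))) (m+n∸m≡n m (suc e)))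

prec-even-gap : ∀ {m} i {D} → m + double i ≡ D → prec (suc D) m ≡ suc i
prec-even-gap i ≡D = trans (prec-gap ≡D) (cong suc (⌊double/2⌋ i))

prec-odd-gap : ∀ {m} i {D} → m + suc (double i) ≡ D → prec (suc D) m ≡ suc i
prec-odd-gap i ≡D = trans (prec-gap ≡D) (cong suc (⌊suc-double/2⌋ i))

prec-beyond : ∀ {m D} → D < m → prec (suc D) m ≡ 0
prec-beyond D<m = cong (λ k → ⌊ suc k /2⌋) (m≤n⇒m∸n≡0 D<m)

aWords-length : ∀ i → All (λ w → length w ≡ double i) (aWords i)
aWords-length zero = refl ∷ []
aWords-length (suc i) = concat⁺ (map⁺ (All.map (λ {w} eq → extend w eq ∷ extend w eq ∷ []) (aWords-length i)))
  where
    extend : ∀ w {s t} → length w ≡ double i → length (w ++ s ∷ t ∷ []) ≡ double (suc i)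
    extend w eq = trans (length-++ w) (trans (cong (_+ 2) eq) (+-comm (double i) 2))

length-++-pair : ∀ x (c t : Letter) i → length (x ++ c ∷ t ∷ []) + double i ≡ length x + double (suc i)
length-++-pair x c t i = trans (cong (_+ double i) (length-++ x)) (+-assoc (length x) 2 (double i))

branchCount : ∀ {n} → Aut n → Word → Letter → ℕ → ℕ
branchCount σ x c i = Qterm σ (x ++ c ∷ a ∷ []) i + Qterm σ (x ++ c ∷ b ∷ []) i

imbalance : ∀ {n} → Aut n → Word → ℕ → Bool
imbalance σ x i = odd (branchCount σ x b i + branchCount σ x a i)

-- isM n σ is all (P≡P₀ n σ) (words≤ n), and isB' n σ is isM n σ ∧ P≡1 n σ [], definitionally.
P≡1 : (n : ℕ) → Aut n → Word → Bool
P≡1 n σ x = congMod (Ptr σ x (prec n (length x))) (+ 1) (prec n (length x))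

P≡P₀ : (n : ℕ) → Aut n → Word → Bool
P≡P₀ n σ x = congMod (Ptr σ x (prec n (length x))) (Ptr σ [] (prec n (length x))) (prec n (length x))

P≡1-at : ∀ {n} (σ : Aut n) x {k} → prec n (length x) ≡ k → P≡1 n σ x ≡ congMod (Ptr σ x k) (+ 1) k
P≡1-at σ x refl = refl

P≡P₀-at : ∀ {n} (σ : Aut n) x {k} → prec n (length x) ≡ k → P≡P₀ n σ x ≡ congMod (Ptr σ x k) (Ptr σ [] k) k
P≡P₀-at σ x refl = refl

P≡P₀≡P≡1 : ∀ {n} (σ : Aut n) x {k} → prec n (length x) ≡ k → Ptr σ [] k ≡ + 1 → P≡P₀ n σ x ≡ P≡1 n σ x
P≡P₀≡P≡1 σ x {k} prec≡k root≡1 =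
  trans (P≡P₀-at σ x prec≡k) (trans (cong (λ v → congMod (Ptr σ x k) v k) root≡1) (sym (P≡1-at σ x prec≡k)))

Balanced : (D : ℕ) → Aut (suc D) → Set
Balanced D σ = ∀ x i → length x + double (suc i) ≡ D → imbalance σ x i ≡ false

gap-bound : ∀ m e {D} → suc m + e ≡ D → e < D
gap-bound m e ≡D = ≤-trans (s≤s (m≤n+m e m)) (≤-reflexive ≡D)

module Concentrated {D : ℕ} {σ : Aut (suc D)} (fix : FixesUpTo D σ) where

  Par-off-top : ∀ x → length x ≢ D → Par σ x ≡ false
  Par-off-top x ≢D with <-cmp (length x) D
  ... | tri< <D _ _ = Par-fixed fix x <D
  ... | tri≈ _ ≡D _ = contradiction ≡D ≢D
  ... | tri> _ _ D< = Par-beyond σ x D<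

  Qterm-off-top : ∀ y i → length y + double i ≢ D → Qterm σ y i ≡ 0
  Qterm-off-top y i ≢D = sum-map-zero (All.map (λ {w} |w| → cong bit (Par-off-top (y ++ w)
    (λ ≡D → ≢D (trans (sym (trans (length-++ y) (cong (_+_ (length y)) |w|))) ≡D)))) (aWords-length i))

  Qtr-off-top : ∀ y K → (∀ i → i < K → length y + double i ≢ D) → Qtr σ y K ≡ 0
  Qtr-off-top y zero _ = refl
  Qtr-off-top y (suc K) off
    rewrite Qtr-off-top y K (λ i i<K → off i (m<n⇒m<1+n i<K)) | Qterm-off-top y K (off K ≤-refl)
    = *-zeroʳ (2 ^ K)

  Qtr-top : ∀ y i → length y + double i ≡ D → Qtr σ y (suc i) ≡ 2 ^ i * Qterm σ y i
  Qtr-top y i ≡D = cong (_+ 2 ^ i * Qterm σ y i) (Qtr-off-top y i below)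
    where
      below : ∀ j → j < i → length y + double j ≢ D
      below j j<i ≡D′ = <-irrefl (trans ≡D′ (sym ≡D)) (+-monoʳ-< (length y) (≤-trans (n≤1+n _) (double-mono-≤ j<i)))

  Qtr-pair-off-top : ∀ x c t K → (∀ j → j < K → length x + double (suc j) ≢ D) → Qtr σ (x ++ c ∷ t ∷ []) K ≡ 0
  Qtr-pair-off-top x c t K off =
    Qtr-off-top (x ++ c ∷ t ∷ []) K (λ j j<K ≡D → off j j<K (trans (sym (length-++-pair x c t j)) ≡D))

  Qtr-pair-top : ∀ x c t i → length x + double (suc i) ≡ D →
    Qtr σ (x ++ c ∷ t ∷ []) (suc i) ≡ 2 ^ i * Qterm σ (x ++ c ∷ t ∷ []) i
  Qtr-pair-top x c t i ≡D = Qtr-top (x ++ c ∷ t ∷ []) i (trans (length-++-pair x c t i) ≡D)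

  Ptr-trivial : ∀ x K → length x ≢ D → (∀ j → j < K → length x + double (suc j) ≢ D) → Ptr σ x (suc K) ≡ + 1
  Ptr-trivial x K ≢D off
    rewrite Par-off-top x ≢D
          | Qtr-pair-off-top x b a K off | Qtr-pair-off-top x b b K off
          | Qtr-pair-off-top x a a K off | Qtr-pair-off-top x a b K off
    = refl

  Ptr-even-gap : ∀ x i → length x + double (suc i) ≡ D →
    Ptr σ x (2 + i) ≡ + 1 +ℤ + 2 *ℤ + (2 ^ i * branchCount σ x b i) -ℤ + 2 *ℤ + (2 ^ i * branchCount σ x a i)
  Ptr-even-gap x i ≡D
    rewrite Par-off-top x (λ ≡D′ → m+1+n≢m (length x) (trans ≡D (sym ≡D′)))
          | Qtr-pair-top x b a i ≡D | Qtr-pair-top x b b i ≡D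
          | Qtr-pair-top x a a i ≡D | Qtr-pair-top x a b i ≡D
    = cong₂ (λ p q → + 1 +ℤ + 2 *ℤ + p -ℤ + 2 *ℤ + q)
        (sym (*-distribˡ-+ (2 ^ i) _ _)) (sym (*-distribˡ-+ (2 ^ i) _ _))

  Ptr-root : ∀ i → double i < D → Ptr σ [] (suc i) ≡ + 1
  Ptr-root i <D = Ptr-trivial [] i (<⇒≢ (≤-<-trans z≤n <D))
    (λ j j<i ≡D → <-irrefl ≡D (≤-<-trans (double-mono-≤ j<i) <D))

  P≡1-beyond : ∀ x → D < length x → P≡1 (suc D) σ x ≡ true
  P≡1-beyond x D< = trans (P≡1-at σ x (prec-beyond D<)) (congMod-zero (Ptr σ x 0) (+ 1))

  P≡1-top : ∀ x → length x + 0 ≡ D → P≡1 (suc D) σ x ≡ true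
  P≡1-top x ≡D = trans (P≡1-at σ x (prec-even-gap 0 ≡D)) (congMod-sign (Par σ x))

  P≡1-odd-gap : ∀ x i → length x + suc (double i) ≡ D → P≡1 (suc D) σ x ≡ true
  P≡1-odd-gap x i ≡D = begin
    P≡1 (suc D) σ x                                 ≡⟨ P≡1-at σ x (prec-odd-gap i ≡D) ⟩
    congMod (Ptr σ x (suc i)) (+ 1) (suc i)          ≡⟨ cong (λ u → congMod u (+ 1) (suc i)) (Ptr-trivial x i ≢D off) ⟩
    congMod (+ 1) (+ 1) (suc i)                      ≡⟨ congMod-refl (+ 1) (suc i) ⟩
    true                                             ∎
    where
      open ≡-Reasoning
      ≢D : length x ≢ D
      ≢D ≡D′ = m+1+n≢m (length x) (trans ≡D (sym ≡D′))
      off : ∀ j → j < i → length x + double (suc j) ≢ D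
      off j _ ≡D′ = double≢suc-double (suc j) i (+-cancelˡ-≡ (length x) _ _ (trans ≡D′ (sym ≡D)))

  P≡1-even-gap : ∀ x i → length x + double (suc i) ≡ D → P≡1 (suc D) σ x ≡ not (imbalance σ x i)
  P≡1-even-gap x i ≡D = begin
    P≡1 (suc D) σ x                                 ≡⟨ P≡1-at σ x (prec-even-gap (suc i) ≡D) ⟩
    congMod (Ptr σ x (2 + i)) (+ 1) (2 + i)          ≡⟨ cong (λ u → congMod u (+ 1) (2 + i)) (Ptr-even-gap x i ≡D) ⟩
    congMod (+ 1 +ℤ + 2 *ℤ + (2 ^ i * branchCount σ x b i) -ℤ + 2 *ℤ + (2 ^ i * branchCount σ x a i)) (+ 1) (2 + i)
                                                     ≡⟨ congMod-1+2^[1+i][B-A] i _ _ ⟩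
    not (imbalance σ x i)                            ∎
    where open ≡-Reasoning

  P≡1-holds : Balanced D σ → ∀ x → P≡1 (suc D) σ x ≡ true
  P≡1-holds bal x with distance (length x) D
  ... | beyond D< = P≡1-beyond x D<
  ... | even-gap zero ≡D = P≡1-top x ≡D
  ... | even-gap (suc i) ≡D = trans (P≡1-even-gap x i ≡D) (cong not (bal x i ≡D))
  ... | odd-gap i ≡D = P≡1-odd-gap x i ≡D

  all-P≡1⇔Balanced : (∀ x → P≡1 (suc D) σ x ≡ true) ⇔ Balanced D σ
  all-P≡1⇔Balanced = mk⇔
    (λ h x i ≡D → Equivalence.to not≡true⇔ (trans (sym (P≡1-even-gap x i ≡D)) (h x)))
    P≡1-holds

  -- At the precision of a node of positive length the truncated Q-sums of the root stop before level D.
  P≡P₀-off-root : ∀ c x → P≡P₀ (suc D) σ (c ∷ x) ≡ P≡1 (suc D) σ (c ∷ x)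
  P≡P₀-off-root c x with distance (length (c ∷ x)) D
  ... | beyond D< = trans (P≡P₀-at σ (c ∷ x) (prec-beyond D<))
                      (trans (congMod-zero (Ptr σ (c ∷ x) 0) (Ptr σ [] 0)) (sym (P≡1-beyond (c ∷ x) D<)))
  ... | even-gap i ≡D = P≡P₀≡P≡1 σ (c ∷ x) (prec-even-gap i ≡D)
                          (Ptr-root i (gap-bound (length x) (double i) ≡D))
  ... | odd-gap i ≡D = P≡P₀≡P≡1 σ (c ∷ x) (prec-odd-gap {length (c ∷ x)} i ≡D)
                         (Ptr-root i (<-trans (n<1+n (double i)) (gap-bound (length x) (suc (double i)) ≡D)))

  B'⇔all-P≡1 : isB' (suc D) σ ≡ true ⇔ (∀ x → P≡1 (suc D) σ x ≡ true)
  B'⇔all-P≡1 = mk⇔ to from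
    where
      to : isB' (suc D) σ ≡ true → ∀ x → P≡1 (suc D) σ x ≡ true
      to B' [] = proj₂ (Equivalence.to ∧≡true⇔ B')
      to B' (c ∷ x) with ≤-<-connex (length (c ∷ x)) D
      ... | inj₁ ≤D = trans (sym (P≡P₀-off-root c x))
              (Equivalence.to (all-words≤⇔ (P≡P₀ (suc D) σ) (suc D)) (proj₁ (Equivalence.to ∧≡true⇔ B'))
                 (c ∷ x) (m≤n⇒m≤1+n ≤D))
      ... | inj₂ D< = P≡1-beyond (c ∷ x) D<
      from : (∀ x → P≡1 (suc D) σ x ≡ true) → isB' (suc D) σ ≡ true
      from h = Equivalence.from ∧≡true⇔ (Equivalence.from (all-words≤⇔ (P≡P₀ (suc D) σ) (suc D)) M , h [])
        where
          M : ∀ x → length x ≤ suc D → P≡P₀ (suc D) σ x ≡ true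
          M [] _ = congMod-refl (Ptr σ [] (prec (suc D) 0)) (prec (suc D) 0)
          M (c ∷ x) _ = trans (P≡P₀-off-root c x) (h (c ∷ x))

isE⇔FixesUpTo×Balanced : ∀ D (σ : Aut (suc D)) → isE (suc D) σ ≡ true ⇔ (FixesUpTo D σ × Balanced D σ)
isE⇔FixesUpTo×Balanced D σ = mk⇔
  (λ h → let B' , fixed = Equivalence.to ∧≡true⇔ h
             fix = Equivalence.to (fixesUpTo⇔FixesUpTo D σ) fixed
             open Concentrated fix
         in fix , Equivalence.to all-P≡1⇔Balanced (Equivalence.to B'⇔all-P≡1 B'))
  (λ { (fix , bal) → let open Concentrated fix in Equivalence.from ∧≡true⇔
         (Equivalence.from B'⇔all-P≡1 (Equivalence.from all-P≡1⇔Balanced bal) ,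
          Equivalence.from (fixesUpTo⇔FixesUpTo D σ) fix) })

-- E_n is a group

module _ {D : ℕ} (σ τ : Aut (suc D)) (τ-fix : FixesUpTo D τ) where

  odd-Qterm-∘ : ∀ y i → odd (Qterm (σ ∘A τ) y i) ≡ odd (Qterm σ y i) xor odd (Qterm τ y i)
  odd-Qterm-∘ y i = odd-count-xor (λ w → Par (σ ∘A τ) (y ++ w)) (λ w → Par σ (y ++ w)) (λ w → Par τ (y ++ w))
    (λ w → Par-∘-fixing σ τ τ-fix (y ++ w)) (aWords i)

  odd-branchCount-∘ : ∀ x c i → odd (branchCount (σ ∘A τ) x c i) ≡ odd (branchCount σ x c i) xor odd (branchCount τ x c i)
  odd-branchCount-∘ x c i = odd-+-additive (λ y → Qterm (σ ∘A τ) y i) (λ y → Qterm σ y i) (λ y → Qterm τ y i)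
    (λ y → odd-Qterm-∘ y i) (x ++ c ∷ a ∷ []) (x ++ c ∷ b ∷ [])

  imbalance-∘ : ∀ x i → imbalance (σ ∘A τ) x i ≡ imbalance σ x i xor imbalance τ x i
  imbalance-∘ x i = odd-+-additive (λ c → branchCount (σ ∘A τ) x c i) (λ c → branchCount σ x c i) (λ c → branchCount τ x c i)
    (λ c → odd-branchCount-∘ x c i) b a

Qterm-idA : ∀ n y i → Qterm (idA n) y i ≡ 0
Qterm-idA n y i = sum-map-zero (All.tabulate {xs = aWords i} (λ {w} _ → cong bit (Par-idA n (y ++ w))))
  where
    Par-idA : ∀ n x → Par (idA n) x ≡ false
    Par-idA zero x = refl
    Par-idA (suc n) [] = refl
    Par-idA (suc n) (a ∷ x) = Par-idA n x
    Par-idA (suc n) (b ∷ x) = Par-idA n x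

isE-idA : ∀ D → isE (suc D) (idA (suc D)) ≡ true
isE-idA D = Equivalence.from (isE⇔FixesUpTo×Balanced D (idA (suc D))) (fixes-idA D (suc D) , balanced)
  where
    balanced : Balanced D (idA (suc D))
    balanced x i _ rewrite Qterm-idA (suc D) (x ++ b ∷ a ∷ []) i | Qterm-idA (suc D) (x ++ b ∷ b ∷ []) i
                         | Qterm-idA (suc D) (x ++ a ∷ a ∷ []) i | Qterm-idA (suc D) (x ++ a ∷ b ∷ []) i = refl

isE-∘ : ∀ D (σ τ : Aut (suc D)) → isE (suc D) σ ≡ true → isE (suc D) τ ≡ true → isE (suc D) (σ ∘A τ) ≡ true
isE-∘ D σ τ σ∈E τ∈E
  with Equivalence.to (isE⇔FixesUpTo×Balanced D σ) σ∈E | Equivalence.to (isE⇔FixesUpTo×Balanced D τ) τ∈E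
... | σ-fix , σ-bal | τ-fix , τ-bal = Equivalence.from (isE⇔FixesUpTo×Balanced D (σ ∘A τ))
  (fixes-∘ σ-fix τ-fix , λ x i ≡D → trans (imbalance-∘ σ τ τ-fix x i) (cong₂ _xor_ (σ-bal x i ≡D) (τ-bal x i ≡D)))

isE-invA : ∀ D (σ : Aut (suc D)) → isE (suc D) σ ≡ true → isE (suc D) (invA σ) ≡ true
isE-invA D σ σ∈E = subst (λ ρ → isE (suc D) ρ ≡ true)
  (sym (invA≡self (proj₁ (Equivalence.to (isE⇔FixesUpTo×Balanced D σ) σ∈E)))) σ∈E

-- Recursive structure of E_n

RootBalanced : ∀ {n} → ℕ → Aut n → Set
RootBalanced k σ = ∀ i → double (suc i) ≡ suc k → imbalance σ [] i ≡ false

isE-node⇔ : ∀ k p (l r : Aut (suc k)) → isE (2 + k) (node p l r) ≡ true ⇔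
  (p ≡ false × isE (suc k) l ≡ true × isE (suc k) r ≡ true × RootBalanced k (node p l r))
isE-node⇔ k p l r = mk⇔ to from
  where
    to : isE (2 + k) (node p l r) ≡ true →
      p ≡ false × isE (suc k) l ≡ true × isE (suc k) r ≡ true × RootBalanced k (node p l r)
    to σ∈E with Equivalence.to (isE⇔FixesUpTo×Balanced (suc k) (node p l r)) σ∈E
    ... | fixes-node l-fix r-fix , bal =
      refl , Equivalence.from (isE⇔FixesUpTo×Balanced k l) (l-fix , λ x i ≡k → bal (a ∷ x) i (cong suc ≡k))
           , Equivalence.from (isE⇔FixesUpTo×Balanced k r) (r-fix , λ x i ≡k → bal (b ∷ x) i (cong suc ≡k))
           , bal []
    from : p ≡ false × isE (suc k) l ≡ true × isE (suc k) r ≡ true × RootBalanced k (node p l r) →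
      isE (2 + k) (node p l r) ≡ true
    from (refl , l∈E , r∈E , root)
      with Equivalence.to (isE⇔FixesUpTo×Balanced k l) l∈E | Equivalence.to (isE⇔FixesUpTo×Balanced k r) r∈E
    ... | l-fix , l-bal | r-fix , r-bal =
      Equivalence.from (isE⇔FixesUpTo×Balanced (suc k) (node p l r)) (fixes-node l-fix r-fix , bal)
      where
        bal : Balanced (suc k) (node false l r)
        bal [] = root
        bal (a ∷ x) i ≡k = l-bal x i (suc-injective ≡k)
        bal (b ∷ x) i ≡k = r-bal x i (suc-injective ≡k)

isE-node-true : ∀ k (l r : Aut (suc k)) → isE (2 + k) (node true l r) ≡ false
isE-node-true k l r = ¬-not (λ σ∈E → case proj₁ (Equivalence.to (isE-node⇔ k true l r) σ∈E) of λ ())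

E-embeds-in-E×E : ∀ k (σ : Aut (2 + k)) → isE (2 + k) σ ≡ true →
  Σ (Aut (suc k)) λ σa → Σ (Aut (suc k)) λ σb → isE (suc k) σa ≡ true × isE (suc k) σb ≡ true × σ ≡ embed σa σb
E-embeds-in-E×E k (node p l r) σ∈E with Equivalence.to (isE-node⇔ k p l r) σ∈E
... | refl , l∈E , r∈E , _ = l , r , l∈E , r∈E , refl

-- For σ ∈ E_{2i+1}, digit₀ i σ is the coefficient of 2^i in Q(σ,x₀) mod 2; for σ ∈ E_{2i+2},
-- digit₁ i σ is that of Q(σ,a) + Q(σ,b).
digit₀ : ∀ {n} → ℕ → Aut n → Bool
digit₀ i σ = odd (Qterm σ [] i)

digit₁ : ∀ {n} → ℕ → Aut n → Bool
digit₁ i σ = odd (Qterm σ (a ∷ []) i + Qterm σ (b ∷ []) i)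

sum-aWords-suc : ∀ i (f : Word → ℕ) → sumℕ (map f (aWords (suc i))) ≡
  sumℕ (map (λ w → f (a ∷ a ∷ w)) (aWords i)) + sumℕ (map (λ w → f (a ∷ b ∷ w)) (aWords i))
sum-aWords-suc zero f = cong (_+ (f (a ∷ b ∷ []) + 0)) (sym (+-identityʳ (f (a ∷ a ∷ []))))
sum-aWords-suc (suc i) f = begin
  sumℕ (map f (aWords (2 + i)))                  ≡⟨ sum-map-concatMap f extend (aWords (suc i)) ⟩
  sumℕ (map g (aWords (suc i)))                  ≡⟨ sum-aWords-suc i g ⟩
  sumℕ (map (λ w → g (a ∷ a ∷ w)) (aWords i)) + sumℕ (map (λ w → g (a ∷ b ∷ w)) (aWords i))
    ≡⟨ sym (cong₂ _+_ (sum-map-concatMap (λ w → f (a ∷ a ∷ w)) extend (aWords i))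
                      (sum-map-concatMap (λ w → f (a ∷ b ∷ w)) extend (aWords i))) ⟩
  sumℕ (map (λ w → f (a ∷ a ∷ w)) (aWords (suc i))) + sumℕ (map (λ w → f (a ∷ b ∷ w)) (aWords (suc i))) ∎
  where
    open ≡-Reasoning
    extend : Word → List Word
    extend w = (w ++ a ∷ a ∷ []) ∷ (w ++ a ∷ b ∷ []) ∷ []
    g : Word → ℕ
    g w = sumℕ (map f (extend w))

digit₀-node : ∀ {n} i p (l r : Aut n) → digit₀ (suc i) (node p l r) ≡ digit₁ i l
digit₀-node i p l r = cong odd (sum-aWords-suc i (λ w → bit (Par (node p l r) w)))

digit₁-node : ∀ {n} i p (l r : Aut n) → digit₁ i (node p l r) ≡ digit₀ i l xor digit₀ i r
digit₁-node i p l r = odd-+ (Qterm l [] i) (Qterm r [] i)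

imbalance-root : ∀ {n} i p (l r : Aut n) → imbalance (node p l r) [] i ≡ digit₁ i l xor digit₁ i r
imbalance-root i p l r = trans (odd-+ (Qterm r (a ∷ []) i + Qterm r (b ∷ []) i) (Qterm l (a ∷ []) i + Qterm l (b ∷ []) i))
                               (xor-comm (digit₁ i r) (digit₁ i l))

isE-even-node : ∀ i p (l r : Aut (suc (double i))) →
  isE (2 + double i) (node p l r) ≡ not p ∧ (isE (suc (double i)) l ∧ isE (suc (double i)) r)
isE-even-node i p l r = ⇔→≡ (mk⇔
  (λ σ∈E → let p≡false , l∈E , r∈E , _ = Equivalence.to (isE-node⇔ (double i) p l r) σ∈E
           in Equivalence.from not∧∧≡true⇔ (p≡false , l∈E , r∈E))
  (λ h → let p≡false , l∈E , r∈E = Equivalence.to not∧∧≡true⇔ h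
         in Equivalence.from (isE-node⇔ (double i) p l r) (p≡false , l∈E , r∈E , no-root)))
  where
    no-root : RootBalanced (double i) (node p l r)
    no-root j eq = contradiction (sym (suc-injective eq)) (double≢suc-double i j)

isE-odd-node : ∀ i p (l r : Aut (2 + double i)) →
  isE (3 + double i) (node p l r) ≡ not p ∧ ((isE (2 + double i) l ∧ isE (2 + double i) r) ∧ not (digit₁ i l xor digit₁ i r))
isE-odd-node i p l r = ⇔→≡ (mk⇔
  (λ σ∈E → let p≡false , l∈E , r∈E , root = Equivalence.to (isE-node⇔ (suc (double i)) p l r) σ∈E
           in Equivalence.from not∧∧≡true⇔ (p≡false , Equivalence.from ∧≡true⇔ (l∈E , r∈E) ,
                Equivalence.from not≡true⇔ (trans (sym (imbalance-root i p l r)) (root i refl))))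
  (λ h → let p≡false , lr∈E , balanced = Equivalence.to not∧∧≡true⇔ h
             l∈E , r∈E = Equivalence.to ∧≡true⇔ lr∈E
             root : RootBalanced (suc (double i)) (node p l r)
             root j eq = subst (λ j → imbalance (node p l r) [] j ≡ false)
               (sym (double-injective (suc-injective (suc-injective eq))))
               (trans (imbalance-root i p l r) (Equivalence.to not≡true⇔ balanced))
         in Equivalence.from (isE-node⇔ (suc (double i)) p l r) (p≡false , l∈E , r∈E , root)))

-- Counting

ΣA : (n : ℕ) → (Aut n → ℕ) → ℕ
ΣA n f = sumℕ (map f (allAut n))

ΣA-cong : ∀ n {f g : Aut n → ℕ} → (∀ σ → f σ ≡ g σ) → ΣA n f ≡ ΣA n g
ΣA-cong n f≗g = cong sumℕ (map-cong f≗g (allAut n))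

ΣA-zero : ∀ n {f : Aut n → ℕ} → (∀ σ → f σ ≡ 0) → ΣA n f ≡ 0
ΣA-zero n f≡0 = sum-map-zero (All.tabulate {xs = allAut n} (λ {σ} _ → f≡0 σ))

ΣA-+ : ∀ n (f g : Aut n → ℕ) → ΣA n (λ σ → f σ + g σ) ≡ ΣA n f + ΣA n g
ΣA-+ n f g = sum-map-+ f g (allAut n)

ΣA-product : ∀ n (f g : Aut n → ℕ) → ΣA n (λ l → ΣA n (λ r → f l * g r)) ≡ ΣA n f * ΣA n g
ΣA-product n f g = trans (ΣA-cong n (λ l → sum-map-*ˡ (f l) g (allAut n))) (sum-map-*ʳ (ΣA n g) f (allAut n))

ΣA-product₂ : ∀ n (f g h k : Aut n → ℕ) →
  ΣA n (λ l → ΣA n (λ r → f l * g r + h l * k r)) ≡ ΣA n f * ΣA n g + ΣA n h * ΣA n k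
ΣA-product₂ n f g h k = begin
  ΣA n (λ l → ΣA n (λ r → f l * g r + h l * k r))
    ≡⟨ ΣA-cong n (λ l → ΣA-+ n (λ r → f l * g r) (λ r → h l * k r)) ⟩
  ΣA n (λ l → ΣA n (λ r → f l * g r) + ΣA n (λ r → h l * k r))
    ≡⟨ ΣA-+ n _ _ ⟩
  ΣA n (λ l → ΣA n (λ r → f l * g r)) + ΣA n (λ l → ΣA n (λ r → h l * k r))
    ≡⟨ cong₂ _+_ (ΣA-product n f g) (ΣA-product n h k) ⟩
  ΣA n f * ΣA n g + ΣA n h * ΣA n k ∎
  where open ≡-Reasoning

ΣA-node : ∀ n (f : Aut (suc n) → ℕ) → (∀ l r → f (node true l r) ≡ 0) →
  ΣA (suc n) f ≡ ΣA n (λ l → ΣA n (λ r → f (node false l r)))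
ΣA-node n f node-true≡0 = begin
  ΣA (suc n) f                                    ≡⟨ sum-map-concatMap f level (false ∷ true ∷ []) ⟩
  Σlevel false + (Σlevel true + 0)                ≡⟨ cong (λ s → Σlevel false + (s + 0)) Σlevel-true≡0 ⟩
  Σlevel false + 0                                ≡⟨ +-identityʳ (Σlevel false) ⟩
  Σlevel false                                    ≡⟨ sum-map-concatMap f (λ l → map (node false l) (allAut n)) (allAut n) ⟩
  ΣA n (λ l → sumℕ (map f (map (node false l) (allAut n))))
    ≡⟨ ΣA-cong n (λ l → cong sumℕ (sym (map-∘ (allAut n)))) ⟩
  ΣA n (λ l → ΣA n (λ r → f (node false l r)))    ∎
  where
    open ≡-Reasoning
    level : Bool → List (Aut (suc n))
    level p = concatMap (λ l → map (node p l) (allAut n)) (allAut n)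
    Σlevel : Bool → ℕ
    Σlevel p = sumℕ (map f (level p))
    Σlevel-true≡0 : Σlevel true ≡ 0
    Σlevel-true≡0 = trans (sum-map-concatMap f (λ l → map (node true l) (allAut n)) (allAut n))
      (ΣA-zero n (λ l → trans (cong sumℕ (sym (map-∘ (allAut n)))) (ΣA-zero n (node-true≡0 l))))

bit-∧ : ∀ x y → bit (x ∧ y) ≡ bit x * bit y
bit-∧ true y = sym (+-identityʳ (bit y))
bit-∧ false y = refl

bit-split : ∀ x y → bit x ≡ bit (x ∧ y) + bit (x ∧ not y)
bit-split true true = refl
bit-split true false = refl
bit-split false y = refl

bit-xor : ∀ x y u v → bit ((x ∧ y) ∧ (u xor v)) ≡ bit (x ∧ u) * bit (y ∧ not v) + bit (x ∧ not u) * bit (y ∧ v)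
bit-xor false y u v = refl
bit-xor true false true v = refl
bit-xor true false false v = refl
bit-xor true true true true = refl
bit-xor true true true false = refl
bit-xor true true false true = refl
bit-xor true true false false = refl

bit-xnor : ∀ x y u v → bit ((x ∧ y) ∧ not (u xor v)) ≡ bit (x ∧ u) * bit (y ∧ v) + bit (x ∧ not u) * bit (y ∧ not v)
bit-xnor false y u v = refl
bit-xnor true false true v = refl
bit-xnor true false false v = refl
bit-xnor true true true true = refl
bit-xnor true true true false = refl
bit-xnor true true false true = refl
bit-xnor true true false false = refl

bit-xnor-∧ : ∀ x y u v → bit (((x ∧ y) ∧ not (u xor v)) ∧ u) ≡ bit (x ∧ u) * bit (y ∧ v)
bit-xnor-∧ false y u v = refl
bit-xnor-∧ true false true v = refl
bit-xnor-∧ true false false v = refl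
bit-xnor-∧ true true true true = refl
bit-xnor-∧ true true true false = refl
bit-xnor-∧ true true false true = refl
bit-xnor-∧ true true false false = refl

bit-xnor-∧-not : ∀ x y u v → bit (((x ∧ y) ∧ not (u xor v)) ∧ not u) ≡ bit (x ∧ not u) * bit (y ∧ not v)
bit-xnor-∧-not false y u v = refl
bit-xnor-∧-not true false true v = refl
bit-xnor-∧-not true false false v = refl
bit-xnor-∧-not true true true true = refl
bit-xnor-∧-not true true true false = refl
bit-xnor-∧-not true true false true = refl
bit-xnor-∧-not true true false false = refl

#E : (n : ℕ) → (Aut n → Bool) → ℕ
#E n P = ΣA n (λ σ → bit (isE n σ ∧ P σ))

cardE≡ΣA : ∀ n → cardE n ≡ ΣA n (bit ∘ isE n)
cardE≡ΣA n = length-filter≡count (isE n) (allAut n)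

cardE≡#E : ∀ n → cardE n ≡ #E n (λ _ → true)
cardE≡#E n = trans (cardE≡ΣA n) (ΣA-cong n (λ σ → cong bit (sym (∧-identityʳ (isE n σ)))))

cardE-split : ∀ n (P : Aut n → Bool) → cardE n ≡ #E n P + #E n (not ∘ P)
cardE-split n P = trans (cardE≡ΣA n) (trans (ΣA-cong n (λ σ → bit-split (isE n σ) (P σ))) (ΣA-+ n _ _))

#E-pairs : ∀ k (P : Aut (2 + k) → Bool) (F : Aut (suc k) → Aut (suc k) → ℕ) →
  (∀ l r → bit (isE (2 + k) (node false l r) ∧ P (node false l r)) ≡ F l r) →
  #E (2 + k) P ≡ ΣA (suc k) (λ l → ΣA (suc k) (F l))
#E-pairs k P F pointwise = trans
  (ΣA-node (suc k) _ (λ l r → cong (λ e → bit (e ∧ P (node true l r))) (isE-node-true k l r)))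
  (ΣA-cong (suc k) (λ l → ΣA-cong (suc k) (pointwise l)))

module _ (i : ℕ) where
  private
    m = suc (double i)
    χ⁺ χ⁻ : Aut m → ℕ
    χ⁺ σ = bit (isE m σ ∧ digit₀ i σ)
    χ⁻ σ = bit (isE m σ ∧ not (digit₀ i σ))

  cardE-even : cardE (suc m) ≡ cardE m * cardE m
  cardE-even = begin
    cardE (suc m)                                            ≡⟨ cardE≡#E (suc m) ⟩
    #E (suc m) (λ _ → true)                                  ≡⟨ #E-pairs (double i) _ _ pointwise ⟩
    ΣA m (λ l → ΣA m (λ r → bit (isE m l) * bit (isE m r)))  ≡⟨ ΣA-product m _ _ ⟩
    ΣA m (bit ∘ isE m) * ΣA m (bit ∘ isE m)                  ≡⟨ sym (cong₂ _*_ (cardE≡ΣA m) (cardE≡ΣA m)) ⟩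
    cardE m * cardE m                                        ∎
    where
      open ≡-Reasoning
      pointwise : ∀ l r → bit (isE (suc m) (node false l r) ∧ true) ≡ bit (isE m l) * bit (isE m r)
      pointwise l r = trans (cong bit (trans (∧-identityʳ _) (isE-even-node i false l r))) (bit-∧ (isE m l) (isE m r))

  #E-digit₁-even : #E (suc m) (digit₁ i) ≡ ΣA m χ⁺ * ΣA m χ⁻ + ΣA m χ⁻ * ΣA m χ⁺
  #E-digit₁-even = trans (#E-pairs (double i) (digit₁ i) _ pointwise) (ΣA-product₂ m χ⁺ χ⁻ χ⁻ χ⁺)
    where
      pointwise : ∀ l r → bit (isE (suc m) (node false l r) ∧ digit₁ i (node false l r)) ≡ χ⁺ l * χ⁻ r + χ⁻ l * χ⁺ r
      pointwise l r = trans (cong₂ (λ e d → bit (e ∧ d)) (isE-even-node i false l r) (digit₁-node i false l r))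
                            (bit-xor (isE m l) (isE m r) (digit₀ i l) (digit₀ i r))

  #E-not-digit₁-even : #E (suc m) (not ∘ digit₁ i) ≡ ΣA m χ⁺ * ΣA m χ⁺ + ΣA m χ⁻ * ΣA m χ⁻
  #E-not-digit₁-even = trans (#E-pairs (double i) (not ∘ digit₁ i) _ pointwise) (ΣA-product₂ m χ⁺ χ⁺ χ⁻ χ⁻)
    where
      pointwise : ∀ l r → bit (isE (suc m) (node false l r) ∧ not (digit₁ i (node false l r))) ≡ χ⁺ l * χ⁺ r + χ⁻ l * χ⁻ r
      pointwise l r = trans (cong₂ (λ e d → bit (e ∧ not d)) (isE-even-node i false l r) (digit₁-node i false l r))
                            (bit-xnor (isE m l) (isE m r) (digit₀ i l) (digit₀ i r))

module _ (i : ℕ) where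
  private
    m = 2 + double i
    χ⁺ χ⁻ : Aut m → ℕ
    χ⁺ σ = bit (isE m σ ∧ digit₁ i σ)
    χ⁻ σ = bit (isE m σ ∧ not (digit₁ i σ))

  cardE-odd : cardE (suc m) ≡ ΣA m χ⁺ * ΣA m χ⁺ + ΣA m χ⁻ * ΣA m χ⁻
  cardE-odd = trans (cardE≡#E (suc m)) (trans (#E-pairs (suc (double i)) _ _ pointwise) (ΣA-product₂ m χ⁺ χ⁺ χ⁻ χ⁻))
    where
      pointwise : ∀ l r → bit (isE (suc m) (node false l r) ∧ true) ≡ χ⁺ l * χ⁺ r + χ⁻ l * χ⁻ r
      pointwise l r = trans (cong bit (trans (∧-identityʳ _) (isE-odd-node i false l r)))
                            (bit-xnor (isE m l) (isE m r) (digit₁ i l) (digit₁ i r))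

  #E-digit₀-odd : #E (suc m) (digit₀ (suc i)) ≡ ΣA m χ⁺ * ΣA m χ⁺
  #E-digit₀-odd = trans (#E-pairs (suc (double i)) (digit₀ (suc i)) _ pointwise) (ΣA-product m χ⁺ χ⁺)
    where
      pointwise : ∀ l r → bit (isE (suc m) (node false l r) ∧ digit₀ (suc i) (node false l r)) ≡ χ⁺ l * χ⁺ r
      pointwise l r = trans (cong₂ (λ e d → bit (e ∧ d)) (isE-odd-node i false l r) (digit₀-node i false l r))
                            (bit-xnor-∧ (isE m l) (isE m r) (digit₁ i l) (digit₁ i r))

  #E-not-digit₀-odd : #E (suc m) (not ∘ digit₀ (suc i)) ≡ ΣA m χ⁻ * ΣA m χ⁻
  #E-not-digit₀-odd = trans (#E-pairs (suc (double i)) (not ∘ digit₀ (suc i)) _ pointwise) (ΣA-product m χ⁻ χ⁻)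
    where
      pointwise : ∀ l r → bit (isE (suc m) (node false l r) ∧ not (digit₀ (suc i) (node false l r))) ≡ χ⁻ l * χ⁻ r
      pointwise l r = trans (cong₂ (λ e d → bit (e ∧ not d)) (isE-odd-node i false l r) (digit₀-node i false l r))
                            (bit-xnor-∧-not (isE m l) (isE m r) (digit₁ i l) (digit₁ i r))

digit₀-equidistributed : ∀ i → #E (suc (double i)) (digit₀ i) ≡ #E (suc (double i)) (not ∘ digit₀ i)
digit₁-equidistributed : ∀ i → #E (2 + double i) (digit₁ i) ≡ #E (2 + double i) (not ∘ digit₁ i)

-- E₁ is all of Aut(T₁), on which digit₀ 0 is the root parity.
digit₀-equidistributed zero = refl
digit₀-equidistributed (suc i) = begin
  #E (3 + double i) (digit₀ (suc i))        ≡⟨ #E-digit₀-odd i ⟩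
  X * X                                     ≡⟨ cong₂ _*_ X≡Y X≡Y ⟩
  Y * Y                                     ≡⟨ sym (#E-not-digit₀-odd i) ⟩
  #E (3 + double i) (not ∘ digit₀ (suc i))  ∎
  where
    open ≡-Reasoning
    X = #E (2 + double i) (digit₁ i)
    Y = #E (2 + double i) (not ∘ digit₁ i)
    X≡Y = digit₁-equidistributed i

digit₁-equidistributed i = begin
  #E (2 + double i) (digit₁ i)        ≡⟨ #E-digit₁-even i ⟩
  X * Y + Y * X                       ≡⟨ cong₂ _+_ (cong (X *_) (sym X≡Y)) (cong (Y *_) X≡Y) ⟩
  X * X + Y * Y                       ≡⟨ sym (#E-not-digit₁-even i) ⟩
  #E (2 + double i) (not ∘ digit₁ i)  ∎
  where
    open ≡-Reasoning
    X = #E (suc (double i)) (digit₀ i)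
    Y = #E (suc (double i)) (not ∘ digit₀ i)
    X≡Y = digit₀-equidistributed i

index-even : ∀ i → cardE (suc (double i)) * cardE (suc (double i)) ≡ 1 * cardE (2 + double i)
index-even i = trans (sym (cardE-even i)) (sym (*-identityˡ _))

index-odd : ∀ i → cardE (2 + double i) * cardE (2 + double i) ≡ 2 * cardE (3 + double i)
index-odd i = begin
  cardE (2 + double i) * cardE (2 + double i)   ≡⟨ cong (λ c → c * c) (cardE-split (2 + double i) (digit₁ i)) ⟩
  (X + Y) * (X + Y)                             ≡⟨ square-of-equal-halves (digit₁-equidistributed i) ⟩
  2 * (X * X + Y * Y)                           ≡⟨ cong (2 *_) (sym (cardE-odd i)) ⟩
  2 * cardE (3 + double i)                      ∎
  where
    open ≡-Reasoning
    X = #E (2 + double i) (digit₁ i)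
    Y = #E (2 + double i) (not ∘ digit₁ i)
    square-of-equal-halves : ∀ {X Y} → X ≡ Y → (X + Y) * (X + Y) ≡ 2 * (X * X + Y * Y)
    square-of-equal-halves {X} refl = identity X
      where
        identity : ∀ Z → (Z + Z) * (Z + Z) ≡ 2 * (Z * Z + Z * Z)
        identity = ℕ-solve-∀

lemma4p4 : (k : ℕ) → let n = suc (suc k) in
    -- E_n ⊆ E_{n-1} × E_{n-1}  (embedded in Aut(T_n))
    ((σ : Aut n) → isE n σ ≡ true →
      Σ (Aut (suc k)) λ σa → Σ (Aut (suc k)) λ σb →
        isE (suc k) σa ≡ true × isE (suc k) σb ≡ true × σ ≡ embed σa σb)
    -- E_n is a subgroup: contains the identity, closed under composition and inverses
    × isE n (idA n) ≡ true
    × ((σ τ : Aut n) → isE n σ ≡ true → isE n τ ≡ true → isE n (σ ∘A τ) ≡ true)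
    × ((σ : Aut n) → isE n σ ≡ true → isE n (invA σ) ≡ true)
    -- index: |E_{n-1} × E_{n-1}| = [E_{n-1}×E_{n-1} : E_n] · |E_n|
    × (n % 2 ≡ 0 → cardE (suc k) * cardE (suc k) ≡ 1 * cardE n)
    × (n % 2 ≡ 1 → cardE (suc k) * cardE (suc k) ≡ 2 * cardE n)
lemma4p4 k = E-embeds-in-E×E k , isE-idA (suc k) , isE-∘ (suc k) , isE-invA (suc k) , index-if-even , index-if-odd
  where
    index-if-even : suc (suc k) % 2 ≡ 0 → cardE (suc k) * cardE (suc k) ≡ 1 * cardE (suc (suc k))
    index-if-even n-even with distance 0 k
    ... | even-gap i refl = index-even i
    ... | odd-gap i refl = contradiction (trans (sym n-even) (suc-double%2 i)) λ ()
    index-if-odd : suc (suc k) % 2 ≡ 1 → cardE (suc k) * cardE (suc k) ≡ 2 * cardE (suc (suc k))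
    index-if-odd n-odd with distance 0 k
    ... | even-gap i refl = contradiction (trans (sym n-odd) (double%2 i)) λ ()
    ... | odd-gap i refl = index-odd i
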